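{- Let $n$ be a positive integer and let $G$ be a finite simple graph with maximum degree $\Delta(G)$. If $\Delta(G)\ge 3n$, then $G$ or its complement $\overline{G}$ contains a copy of $F_n$.
   Context: For a positive integer $n$, the fan $F_n$ is the graph consisting of $n$ triangles that share exactly one common vertex (the center), all other vertices being distinct. $\overline{G}$ denotes the complement graph of $G$. -}

module Defs where

open import Data.Nat using (ℕ; _⊔_)
open import Data.Fin using (Fin)
open import Data.Bool using (Bool; true; false)
open import Data.List using (List; length; filter; foldr; map)
open import Data.List.Base using (allFin)
open import Data.Empty using (⊥)
open import Data.Unit using (⊤)
open import Data.Product using (Σ; _×_)
open import Relation.Nullary using (¬_; Dec)
open import Relation.Binary.PropositionalEquality using (_≡_)
open import Function.Definitions using (Injective)

record Graph (N : ℕ) : Set₁ where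
  field
    Adj    : Fin N → Fin N → Set
    adj?   : ∀ u v → Dec (Adj u v)
    irrefl : ∀ v → ¬ Adj v v
    sym    : ∀ {u v} → Adj u v → Adj v u
open Graph public

complement : ∀ {N} → Graph N → Graph N
complement {N} G = record
  { Adj    = λ u v → ¬ (u ≡ v) × ¬ Adj G u v
  ; adj?   = λ u v → dec u v
  ; irrefl = λ v p → Data.Product.proj₁ p Relation.Binary.PropositionalEquality.refl
  ; sym    = λ { (a , b) → (λ e → a (Relation.Binary.PropositionalEquality.sym e)) , (λ x → b (Graph.sym G x)) }
  }
  where
  open Data.Product using (_,_)
  open import Relation.Nullary using (yes; no)
  open import Relation.Nullary.Decidable using (_×-dec_; ¬?)
  dec : ∀ u v → Dec (¬ (u ≡ v) × ¬ Adj G u v)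
  dec u v = ¬? (u Data.Fin.≟ v) ×-dec ¬? (adj? G u v)

degree : ∀ {N} → Graph N → Fin N → ℕ
degree G v = length (filter (adj? G v) (allFin _))

maxDegree : ∀ {N} → Graph N → ℕ
maxDegree G = foldr _⊔_ 0 (map (degree G) (allFin _))

-- The fan F_n: a centre plus n pairs of leaves; triangle i = {centre, leaf i false, leaf i true}.
data FanV (n : ℕ) : Set where
  centre : FanV n
  leaf   : Fin n → Bool → FanV n

FanAdj : ∀ {n} → FanV n → FanV n → Set
FanAdj centre     centre       = ⊥
FanAdj centre     (leaf _ _)   = ⊤
FanAdj (leaf _ _) centre       = ⊤
FanAdj (leaf i b) (leaf j c)   = (i ≡ j) × ¬ (b ≡ c)

-- H contains a copy of F_n: an injective map of fan vertices preserving edges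
-- (a not-necessarily-induced subgraph).
ContainsFan : ∀ {N} → ℕ → Graph N → Set
ContainsFan {N} n H =
  Σ (FanV n → Fin N) λ f → Injective _≡_ _≡_ f × (∀ u v → FanAdj u v → Adj H (f u) (f v))

module Submission where

-- Take a vertex v of degree at least 3n and grow a matching M inside its neighbourhood,
-- keeping |I| + 2|M| ≥ 3n for the set I of unmatched neighbours: add an edge inside I, or
-- replace a matched edge xy by ax and yb for distinct a, b ∈ I adjacent to x and y. If |M|
-- reaches n, the edges of M together with v form F_n in G. Otherwise I is independent and
-- no matched edge can be replaced, so each matched edge has an endpoint z with at most one
-- neighbour a in I. As |I| > |M| some u ∈ I differs from all these a's, and u is the centre
-- of F_n in the complement: each z forms a triangle with u and one of two fresh vertices of
-- I (at most one of them is its a), and the remaining vertices of I, at least 2(n − |M|)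
-- of them, are paired off.

open import Defs
open import Data.Bool using (false; true)
open import Data.Empty using (⊥-elim)
open import Data.Fin using (Fin; zero; suc; _≟_)
open import Data.Fin.Properties using (suc-injective)
open import Data.List using (List; []; _∷_; _++_; length; foldr; map; filter; allFin)
open import Data.List.Properties using (length-map)
open import Data.List.Membership.Propositional using (_∈_; _∉_; find; lose)
open import Data.List.Membership.Propositional.Properties using (∈-∃++)
import Data.List.Membership.DecPropositional as DecMembership
open import Data.List.Relation.Unary.All as All using (All; []; _∷_)
open import Data.List.Relation.Unary.All.Properties using (map⁺; map⁻; ¬Any⇒All¬; all-filter)
open import Data.List.Relation.Unary.Any using (Any; here; there; any?)
import Data.List.Relation.Unary.Any.Properties as AnyP
open import Data.List.Relation.Unary.AllPairs as AllPairs using ([]; _∷_)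
open import Data.List.Relation.Unary.Unique.Propositional using (Unique)
open import Data.List.Relation.Unary.Unique.Propositional.Properties using (filter⁺; allFin⁺)
open import Data.List.Relation.Binary.Permutation.Propositional as ↭
  using (_↭_; ↭-refl; ↭-prep; ↭-swap; ↭-trans; ↭-sym; ↭⇒↭ₛ)
open import Data.List.Relation.Binary.Permutation.Propositional.Properties
  using (∈-resp-↭; All-resp-↭; ↭-length; shift; shifts; ++⁺ˡ; ++⁺ʳ; ++-comm)
import Data.List.Relation.Binary.Permutation.Setoid.Properties as PermutationSetoid
open import Data.List.Relation.Binary.Sublist.Propositional using (_⊆_; []; _∷_; _∷ʳ_; ⊆-refl)
open import Data.List.Relation.Binary.Sublist.Propositional.Properties
  using (All-resp-⊆) renaming (++⁺ to ⊆-++⁺; ++⁺ˡ to ⊆-++⁺ˡ; ++⁺ʳ to ⊆-++⁺ʳ)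
open import Data.Nat using (ℕ; zero; suc; _≤_; _<_; _+_; _*_; _⊔_; NonZero; z≤n; s≤s; >-nonZero⁻¹)
open import Data.Nat.Properties
  using (⊔-sel; ≤-pred; ≤-trans; +-suc; +-identityʳ; +-cancelʳ-≤; m≤m+n; m<m+n)
open import Data.Nat.Tactic.RingSolver using (solve-∀)
open import Data.Product using (∃; ∃₂; _×_; _,_; proj₁; proj₂)
open import Data.Sum using (_⊎_; inj₁; inj₂)
open import Function using (_∘_)
open import Function.Definitions using (Injective)
open import Relation.Nullary using (¬_; Dec; yes; no)
open import Relation.Nullary.Decidable using (map′; ¬?; _×-dec_; decidable-stable)
open import Relation.Binary.Definitions using (DecidableEquality)
open import Relation.Binary.PropositionalEquality as ≡
  using (_≡_; _≢_; refl; subst; subst₂; cong; setoid)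

private variable
  A : Set
  x y : A
  xs ys : List A

flatten : List (A × A) → List A
flatten []             = []
flatten ((x , y) ∷ ps) = x ∷ y ∷ flatten ps

flatten-↭ : {ps qs : List (A × A)} → ps ↭ qs → flatten ps ↭ flatten qs
flatten-↭ ↭.refl                  = ↭-refl
flatten-↭ (↭.prep _ ps↭qs)        = ↭-prep _ (↭-prep _ (flatten-↭ ps↭qs))
flatten-↭ (↭.swap (x , y) (x′ , y′) ps↭qs) =
  ↭-trans (shifts (x ∷ y ∷ []) (x′ ∷ y′ ∷ [])) (++⁺ˡ (x′ ∷ y′ ∷ x ∷ y ∷ []) (flatten-↭ ps↭qs))
flatten-↭ (↭.trans ps↭qs qs↭rs)   = ↭-trans (flatten-↭ ps↭qs) (flatten-↭ qs↭rs)

Unique-resp-↭ : xs ↭ ys → Unique xs → Unique ys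
Unique-resp-↭ xs↭ys = PermutationSetoid.Unique-resp-↭ (setoid _) (↭⇒↭ₛ xs↭ys)

Unique-resp-⊆ : xs ⊆ ys → Unique ys → Unique xs
Unique-resp-⊆ []           []          = []
Unique-resp-⊆ (_ ∷ʳ xs⊆ys) (_ ∷ ys!)   = Unique-resp-⊆ xs⊆ys ys!
Unique-resp-⊆ (refl ∷ xs⊆ys) (y∉ ∷ ys!) = All-resp-⊆ xs⊆ys y∉ ∷ Unique-resp-⊆ xs⊆ys ys!

∈⇒↭∷ : x ∈ xs → ∃ λ ys → xs ↭ x ∷ ys
∈⇒↭∷ {x = x} x∈xs with ys , zs , refl ← ∈-∃++ x∈xs = ys ++ zs , shift x ys zs

∈×∈⇒↭∷∷ : x ∈ xs → y ∈ xs → x ≢ y → ∃ λ zs → xs ↭ x ∷ y ∷ zs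
∈×∈⇒↭∷∷ {x = x} x∈xs y∈xs x≢y with ys , xs↭ ← ∈⇒↭∷ x∈xs with ∈-resp-↭ xs↭ y∈xs
... | here y≡x = ⊥-elim (x≢y (≡.sym y≡x))
... | there y∈ys with zs , ys↭ ← ∈⇒↭∷ y∈ys = zs , ↭-trans xs↭ (↭-prep x ys↭)

module _ {A B : Set} {P : A → B → Set} {xs : List A} {ys : List B} where

  find₂ : Any (λ a → Any (P a) ys) xs → ∃₂ λ a b → a ∈ xs × b ∈ ys × P a b
  find₂ e with a , a∈ , a-ys ← find e with b , b∈ , Pab ← find a-ys = a , b , a∈ , b∈ , Pab

  lose₂ : ∃₂ (λ a b → a ∈ xs × b ∈ ys × P a b) → Any (λ a → Any (P a) ys) xs
  lose₂ (_ , _ , a∈ , b∈ , Pab) = lose a∈ (lose b∈ Pab)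

module _ {A : Set} (_≟_ : DecidableEquality A) where
  open DecMembership _≟_ using (_∈?_)

  longer-unique⇒∃∉ : {xs ys : List A} → Unique xs → length ys < length xs →
                     ∃ λ u → u ∈ xs × u ∉ ys
  longer-unique⇒∃∉ {[]}     []            ()
  longer-unique⇒∃∉ {x ∷ xs} {ys} (x∉xs ∷ xs!) |ys|<|xs| with x ∈? ys
  ... | no x∉ys = x , here refl , x∉ys
  ... | yes x∈ys with ys′ , ys↭ ← ∈⇒↭∷ x∈ys
    with u , u∈xs , u∉ys′ ←
           longer-unique⇒∃∉ xs! (≤-pred (subst (_< length (x ∷ xs)) (↭-length ys↭) |ys|<|xs|))
    = u , there u∈xs , u∉ys
    where
    u∉ys : u ∉ ys
    u∉ys u∈ys with ∈-resp-↭ ys↭ u∈ys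
    ... | here u≡x = All.lookup x∉xs u∈xs (≡.sym u≡x)
    ... | there u∈ys′ = u∉ys′ u∈ys′

≤-foldr-⊔⇒Any : ∀ {k} (ns : List ℕ) → 0 < k → k ≤ foldr _⊔_ 0 ns → Any (k ≤_) ns
≤-foldr-⊔⇒Any []       (s≤s _) ()
≤-foldr-⊔⇒Any (n ∷ ns) 0<k k≤max with ⊔-sel n (foldr _⊔_ 0 ns)
... | inj₁ max≡n = here (subst (_ ≤_) max≡n k≤max)
... | inj₂ max≡ns = there (≤-foldr-⊔⇒Any ns 0<k (subst (_ ≤_) max≡ns k≤max))

fanMap : ∀ {N} (c : Fin N) (T : List (Fin N × Fin N)) → FanV (length T) → Fin N
fanMap c T              centre            = c
fanMap c ((x , y) ∷ T)  (leaf zero false) = x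
fanMap c ((x , y) ∷ T)  (leaf zero true)  = y
fanMap c (_ ∷ T)        (leaf (suc i) b)  = fanMap c T (leaf i b)

module _ {N : ℕ} {c : Fin N} where

  fanMap-leaf-∈ : ∀ T i b → fanMap c T (leaf i b) ∈ flatten T
  fanMap-leaf-∈ (_ ∷ T) zero    false = here refl
  fanMap-leaf-∈ (_ ∷ T) zero    true  = there (here refl)
  fanMap-leaf-∈ (_ ∷ T) (suc i) b     = there (there (fanMap-leaf-∈ T i b))

  fanMap-injective : ∀ T → Unique (c ∷ flatten T) → Injective _≡_ _≡_ (fanMap c T)
  fanMap-injective T _ {centre} {centre} _ = refl
  fanMap-injective T (c∉ ∷ _) {centre} {leaf j b′} e =
    ⊥-elim (All.lookup c∉ (fanMap-leaf-∈ T j b′) e)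
  fanMap-injective T (c∉ ∷ _) {leaf i b} {centre} e =
    ⊥-elim (All.lookup c∉ (fanMap-leaf-∈ T i b) (≡.sym e))
  fanMap-injective (_ ∷ T) _ {leaf zero false} {leaf zero false} _ = refl
  fanMap-injective (_ ∷ T) (_ ∷ (x≢y ∷ _) ∷ _) {leaf zero false} {leaf zero true} x≡y =
    ⊥-elim (x≢y x≡y)
  fanMap-injective (_ ∷ T) (_ ∷ (x≢y ∷ _) ∷ _) {leaf zero true} {leaf zero false} y≡x =
    ⊥-elim (x≢y (≡.sym y≡x))
  fanMap-injective (_ ∷ T) _ {leaf zero true} {leaf zero true} _ = refl
  fanMap-injective (_ ∷ T) (_ ∷ (_ ∷ x∉) ∷ _) {leaf zero false} {leaf (suc j) b′} e =
    ⊥-elim (All.lookup x∉ (fanMap-leaf-∈ T j b′) e)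
  fanMap-injective (_ ∷ T) (_ ∷ _ ∷ y∉ ∷ _) {leaf zero true} {leaf (suc j) b′} e =
    ⊥-elim (All.lookup y∉ (fanMap-leaf-∈ T j b′) e)
  fanMap-injective (_ ∷ T) (_ ∷ (_ ∷ x∉) ∷ _) {leaf (suc i) b} {leaf zero false} e =
    ⊥-elim (All.lookup x∉ (fanMap-leaf-∈ T i b) (≡.sym e))
  fanMap-injective (_ ∷ T) (_ ∷ _ ∷ y∉ ∷ _) {leaf (suc i) b} {leaf zero true} e =
    ⊥-elim (All.lookup y∉ (fanMap-leaf-∈ T i b) (≡.sym e))
  fanMap-injective (_ ∷ T) ((_ ∷ _ ∷ c∉) ∷ _ ∷ _ ∷ T!) {leaf (suc i) b} {leaf (suc j) b′} e
    with fanMap-injective T (c∉ ∷ T!) {leaf i b} {leaf j b′} e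
  ... | refl = refl

module _ {N : ℕ} (K : Graph N) where

  Triangle : Fin N → Fin N × Fin N → Set
  Triangle c (x , y) = Adj K c x × Adj K c y × Adj K x y

  module _ {c : Fin N} where

    centre-adj-leaf : ∀ {T} → All (Triangle c) T → ∀ i b → Adj K c (fanMap c T (leaf i b))
    centre-adj-leaf ((c~x , _) ∷ _)     zero    false = c~x
    centre-adj-leaf ((_ , c~y , _) ∷ _) zero    true  = c~y
    centre-adj-leaf (_ ∷ triangles)     (suc i) b     = centre-adj-leaf triangles i b

    fanMap-hom : ∀ {T} → All (Triangle c) T → ∀ u w → FanAdj u w → Adj K (fanMap c T u) (fanMap c T w)
    fanMap-hom triangles centre     (leaf j b′) _ = centre-adj-leaf triangles j b′
    fanMap-hom triangles (leaf i b) centre      _ = sym K (centre-adj-leaf triangles i b)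
    fanMap-hom ((_ , _ , x~y) ∷ _) (leaf zero false) (leaf zero true)  _ = x~y
    fanMap-hom ((_ , _ , x~y) ∷ _) (leaf zero true)  (leaf zero false) _ = sym K x~y
    fanMap-hom (_ ∷ _) (leaf zero false) (leaf zero false) (_ , b≢b) = ⊥-elim (b≢b refl)
    fanMap-hom (_ ∷ _) (leaf zero true)  (leaf zero true)  (_ , b≢b) = ⊥-elim (b≢b refl)
    fanMap-hom (_ ∷ triangles) (leaf (suc i) b) (leaf (suc j) b′) (i≡j , b≢b′) =
      fanMap-hom triangles (leaf i b) (leaf j b′) (suc-injective i≡j , b≢b′)

  triangles⇒fan : ∀ c T → Unique (c ∷ flatten T) → All (Triangle c) T → ContainsFan (length T) K
  triangles⇒fan c T T! triangles = fanMap c T , fanMap-injective T T! , fanMap-hom triangles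

  record Draft (c : Fin N) (k : ℕ) (pool : List (Fin N)) : Set where
    field
      triangles  : List (Fin N × Fin N)
      count      : length triangles ≡ k
      triangular : All (Triangle c) triangles
      unique     : Unique (c ∷ flatten triangles ++ pool)

module _ {N : ℕ} {K : Graph N} {c : Fin N} where
  open Draft

  private variable
    k : ℕ
    a b : Fin N
    R R′ : List (Fin N)

  emptyDraft : Unique (c ∷ R) → Draft K c 0 R
  emptyDraft c∷R! = record { triangles = [] ; count = refl ; triangular = [] ; unique = c∷R! }

  reorder : Draft K c k R → R ↭ R′ → Draft K c k R′
  reorder d R↭R′ = record
    { triangles  = triangles d
    ; count      = count d
    ; triangular = triangular d
    ; unique     = Unique-resp-↭ (↭-prep c (++⁺ˡ (flatten (triangles d)) R↭R′)) (unique d)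
    }

  unique-front : (d : Draft K c k (x ∷ y ∷ R)) → Unique (c ∷ x ∷ y ∷ flatten (triangles d) ++ R)
  unique-front {x = x} {y = y} d =
    Unique-resp-↭ (↭-prep c (shifts (flatten (triangles d)) (x ∷ y ∷ []))) (unique d)

  distinct : Draft K c k (x ∷ y ∷ R) → c ≢ x × c ≢ y × x ≢ y
  distinct d with (c≢x ∷ c≢y ∷ _) ∷ (x≢y ∷ _) ∷ _ ← unique-front d = c≢x , c≢y , x≢y

  grow : Draft K c k (x ∷ y ∷ R) → Triangle K c (x , y) → Draft K c (suc k) R
  grow {x = x} {y = y} d xy = record
    { triangles  = (x , y) ∷ triangles d
    ; count      = cong suc (count d)
    ; triangular = xy ∷ triangular d
    ; unique     = unique-front d
    }

  exchange : (d : Draft K c k (a ∷ b ∷ R)) → (x , y) ∈ triangles d →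
             Triangle K c (a , x) → Triangle K c (y , b) → Draft K c (suc k) R
  exchange {a = a} {b = b} {R = R} {x = x} {y = y} d xy∈ ax yb
    with T , T↭ ← ∈⇒↭∷ xy∈ = record
    { triangles  = (a , x) ∷ (y , b) ∷ T
    ; count      = cong suc (≡.trans (≡.sym (↭-length T↭)) (count d))
    ; triangular = ax ∷ yb ∷ All.tail (All-resp-↭ T↭ (triangular d))
    ; unique     = Unique-resp-↭ (↭-prep c rearrange) (unique d)
    }
    where
    open ↭.PermutationReasoning
    rearrange : flatten (triangles d) ++ a ∷ b ∷ R ↭ a ∷ x ∷ y ∷ b ∷ flatten T ++ R
    rearrange = begin
      flatten (triangles d) ++ a ∷ b ∷ R  ↭⟨ ++⁺ʳ (a ∷ b ∷ R) (flatten-↭ T↭) ⟩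
      x ∷ y ∷ flatten T ++ a ∷ b ∷ R      ↭⟨ ↭-prep x (↭-prep y (shifts (flatten T) (a ∷ b ∷ []))) ⟩
      x ∷ y ∷ a ∷ b ∷ flatten T ++ R      ↭⟨ shifts (x ∷ y ∷ []) (a ∷ []) ⟩
      a ∷ x ∷ y ∷ b ∷ flatten T ++ R      ∎

  Draft⇒fan : Draft K c k R → ContainsFan k K
  Draft⇒fan {R = R} d = subst (λ k → ContainsFan k K) (count d)
    (triangles⇒fan K c (triangles d) (Unique-resp-⊆ (refl ∷ ⊆-++⁺ʳ R ⊆-refl) (unique d))
                   (triangular d))

module _ {N : ℕ} (G : Graph N) where

  HasEdge : List (Fin N) → Set
  HasEdge I = ∃₂ λ a b → a ∈ I × b ∈ I × Adj G a b

  hasEdge? : ∀ I → Dec (HasEdge I)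
  hasEdge? I = map′ find₂ lose₂ (any? (λ a → any? (adj? G a) I) I)

  Augmenting : List (Fin N) → Fin N × Fin N → Set
  Augmenting I (x , y) = ∃₂ λ a b → a ∈ I × b ∈ I × a ≢ b × Adj G x a × Adj G y b

  augmenting? : ∀ I p → Dec (Augmenting I p)
  augmenting? I (x , y) =
    map′ find₂ lose₂ (any? (λ a → any? (λ b → ¬? (a ≟ b) ×-dec adj? G x a ×-dec adj? G y b) I) I)

module _ {N : ℕ} (G : Graph N) {c : Fin N} {k : ℕ} {x y : Fin N} {R : List (Fin N)} where

  growᶜ : Draft (complement G) c k (x ∷ y ∷ R) → ¬ Adj G c x → ¬ Adj G c y → ¬ Adj G x y →
          Draft (complement G) c (suc k) R
  growᶜ d c≁x c≁y x≁y =
    let (c≢x , c≢y , x≢y) = distinct d in grow d ((c≢x , c≁x) , (c≢y , c≁y) , (x≢y , x≁y))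

room-for-lonely-ends : ∀ m r l → m + 3 * suc r ≤ suc l → m + suc (r * 2) < l
room-for-lonely-ends m r l room = ≤-pred (≤-trans (m≤m+n _ r) (subst (_≤ suc l) (split m r) room))
  where
  split : ∀ m r → m + 3 * suc r ≡ suc (suc (m + suc (r * 2))) + r
  split = solve-∀

module ComplementFan {N : ℕ} (G : Graph N) (I : List (Fin N))
             (independent : ∀ {a b} → a ∈ I → b ∈ I → ¬ Adj G a b) where

  Lonely : Fin N × Fin N → Set
  Lonely (z , a) = ∀ {w} → w ∈ I → Adj G z w → w ≡ a

  -- If x has a neighbour a in I then a is the only candidate neighbour of y in I, since
  -- (x , y) is not augmenting; otherwise x itself is lonely and the second component is junk.
  lonelyEnd : Fin N × Fin N → Fin N × Fin N
  lonelyEnd (x , y) with any? (adj? G x) I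
  ... | no  _   = x , x
  ... | yes x~I = y , proj₁ (find x~I)

  lonelyEnd-Lonely : ∀ p → ¬ Augmenting G I p → Lonely (lonelyEnd p)
  lonelyEnd-Lonely (x , y) unaugmentable with any? (adj? G x) I
  ... | no x≁I = λ w∈ x~w → ⊥-elim (x≁I (lose w∈ x~w))
  ... | yes x~I with a , a∈ , x~a ← find x~I = λ w∈ y~w →
    decidable-stable (_ ≟ a) λ w≢a →
      unaugmentable (a , _ , a∈ , w∈ , (λ a≡w → w≢a (≡.sym a≡w)) , x~a , y~w)

  lonelyEnds-⊆ : ∀ M → map proj₁ (map lonelyEnd M) ⊆ flatten M
  lonelyEnds-⊆ []            = []
  lonelyEnds-⊆ ((x , y) ∷ M) with any? (adj? G x) I
  ... | no  _ = refl ∷ (y ∷ʳ lonelyEnds-⊆ M)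
  ... | yes _ = x ∷ʳ (refl ∷ lonelyEnds-⊆ M)

  Lonely-misses-one : ∀ z {a p q} → Lonely (z , a) → p ∈ I → q ∈ I → p ≢ q →
                      ¬ Adj G z p ⊎ ¬ Adj G z q
  Lonely-misses-one z {p = p} z-lonely p∈ q∈ p≢q with adj? G z p
  ... | no  z≁p = inj₁ z≁p
  ... | yes z~p = inj₂ λ z~q → p≢q (≡.trans (z-lonely p∈ z~p) (≡.sym (z-lonely q∈ z~q)))

  module _ (u : Fin N) (u∈I : u ∈ I) where

    attach-lonely-end : ∀ {k} z {a} p q P Zs → Lonely (z , a) → ¬ Adj G u z → p ∈ I → q ∈ I →
                        Draft (complement G) u k (p ∷ q ∷ P ++ z ∷ Zs) →
                        ∃ λ r → r ∈ I × Draft (complement G) u (suc k) (r ∷ P ++ Zs)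
    attach-lonely-end z p q P Zs z-lonely u≁z p∈ q∈ d
      with Lonely-misses-one z z-lonely p∈ q∈ (proj₂ (proj₂ (distinct d)))
    ... | inj₁ z≁p = q , q∈ , growᶜ G (reorder d (shift z (p ∷ q ∷ P) Zs)) u≁z (independent u∈I p∈) z≁p
    ... | inj₂ z≁q = p , p∈ , growᶜ G (reorder d z-q-first) u≁z (independent u∈I q∈) z≁q
      where
      z-q-first : p ∷ q ∷ P ++ z ∷ Zs ↭ z ∷ q ∷ p ∷ P ++ Zs
      z-q-first = ↭-trans (shift z (p ∷ q ∷ P) Zs) (↭-prep z (↭-swap p q ↭-refl))

    attach-lonely-ends :
      ∀ {k s} ZA P → All Lonely ZA → All ((u ≢_) ∘ proj₂) ZA → All (_∈ I) P →
      length ZA + s < length P → Draft (complement G) u k (P ++ map proj₁ ZA) →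
      ∃ λ P′ → All (_∈ I) P′ × s < length P′ × Draft (complement G) u (length ZA + k) (P′ ++ [])
    attach-lonely-ends []       P _ _ P⊆I s<|P| d = P , P⊆I , s<|P| , d
    attach-lonely-ends (_ ∷ _) [] _ _ _ () _
    attach-lonely-ends (_ ∷ _) (_ ∷ []) _ _ _ (s≤s ()) _
    attach-lonely-ends {k} ((z , a) ∷ ZA) (p ∷ q ∷ P) (z-lonely ∷ lonelies) (u≢a ∷ u≢as)
                       (p∈ ∷ q∈ ∷ P⊆I) (s≤s (s≤s len)) d
      with r , r∈ , d′ ← attach-lonely-end z p q P (map proj₁ ZA) z-lonely
                           (λ u~z → u≢a (z-lonely u∈I (sym G u~z))) p∈ q∈ d
      with P′ , P′⊆I , s<|P′| , d″ ← attach-lonely-ends ZA (r ∷ P) lonelies u≢as (r∈ ∷ P⊆I) (s≤s len) d′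
      = P′ , P′⊆I , s<|P′| , subst (λ j → Draft (complement G) u j (P′ ++ [])) (+-suc (length ZA) k) d″

    -- t * 2 rather than 2 * t, so that suc t * 2 reduces to suc (suc (t * 2)).
    attach-pairs : ∀ {k} t P R → All (_∈ I) P → t * 2 ≤ length P →
                   Draft (complement G) u k (P ++ R) → ∃ λ R′ → Draft (complement G) u (t + k) R′
    attach-pairs zero    P R _ _ d = P ++ R , d
    attach-pairs (suc t) [] _ _ () _
    attach-pairs (suc t) (_ ∷ []) _ _ (s≤s ()) _
    attach-pairs {k} (suc t) (p ∷ q ∷ P) R (p∈ ∷ q∈ ∷ P⊆I) (s≤s (s≤s len)) d
      with R′ , d′ ← attach-pairs t P R P⊆I len
                       (growᶜ G d (independent u∈I p∈) (independent u∈I q∈) (independent p∈ q∈))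
      = R′ , subst (λ j → Draft (complement G) u j R′) (+-suc t k) d′

  stuck⇒complement-fan : ∀ M r → Unique (flatten M ++ I) → All (¬_ ∘ Augmenting G I) M →
                         length M + 3 * suc r ≤ length I →
                         ContainsFan (length M + suc r) (complement G)
  stuck⇒complement-fan M r M++I! unaugmentable room =
    let (u , u∈I , u∉) = longer-unique⇒∃∉ _≟_ I! |ZA|<|I|
        (P , I↭) = ∈⇒↭∷ u∈I
        (P′ , P′⊆I , 2+2r≤|P′| , d) =
          attach-lonely-ends u u∈I ZA P lonelies (avoids u∉) (P⊆I I↭) (fits I↭)
                             (emptyDraft (start! I↭))
        (_ , d′) = attach-pairs u u∈I (suc r) P′ [] P′⊆I 2+2r≤|P′| d
    in subst (λ j → ContainsFan j (complement G)) fan-size (Draft⇒fan d′)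
    where
    ZA : List (Fin N × Fin N)
    ZA = map lonelyEnd M

    |ZA|≡|M| : length ZA ≡ length M
    |ZA|≡|M| = length-map lonelyEnd M

    I! : Unique I
    I! = Unique-resp-⊆ (⊆-++⁺ˡ (flatten M) ⊆-refl) M++I!

    |ZA|<|I| : length (map proj₂ ZA) < length I
    |ZA|<|I| = subst (_< length I) (≡.sym (≡.trans (length-map proj₂ ZA) |ZA|≡|M|))
                     (≤-trans (m<m+n (length M) (s≤s z≤n)) room)

    lonelies : All Lonely ZA
    lonelies = map⁺ (All.map (λ {p} → lonelyEnd-Lonely p) unaugmentable)

    avoids : ∀ {u} → u ∉ map proj₂ ZA → All ((u ≢_) ∘ proj₂) ZA
    avoids u∉ = map⁻ (¬Any⇒All¬ _ u∉)

    P⊆I : ∀ {u P} → I ↭ u ∷ P → All (_∈ I) P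
    P⊆I I↭ = All.tabulate λ w∈P → ∈-resp-↭ (↭-sym I↭) (there w∈P)

    start! : ∀ {u P} → I ↭ u ∷ P → Unique (u ∷ P ++ map proj₁ ZA)
    start! I↭ = Unique-resp-⊆ (refl ∷ ⊆-++⁺ ⊆-refl (lonelyEnds-⊆ M))
                  (Unique-resp-↭ (↭-trans (++-comm (flatten M) I) (++⁺ʳ (flatten M) I↭)) M++I!)

    fits : ∀ {u P} → I ↭ u ∷ P → length ZA + suc (r * 2) < length P
    fits I↭ = room-for-lonely-ends (length ZA) r _
      (subst₂ (λ m l → m + 3 * suc r ≤ l) (≡.sym |ZA|≡|M|) (↭-length I↭) room)

    fan-size : suc r + (length ZA + 0) ≡ length M + suc r
    fan-size = ≡.trans (cong (λ m → suc r + (m + 0)) |ZA|≡|M|) (+-comm-shuffle (length M) r)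
      where
      +-comm-shuffle : ∀ m r → suc r + (m + 0) ≡ m + suc r
      +-comm-shuffle = solve-∀

room-of-large : ∀ m t l → 3 * (m + t) ≤ l + 2 * m → m + 3 * t ≤ l
room-of-large m t l 3[m+t]≤l+2m =
  +-cancelʳ-≤ (2 * m) (m + 3 * t) l (subst (_≤ l + 2 * m) (distrib m t) 3[m+t]≤l+2m)
  where
  distrib : ∀ m t → 3 * (m + t) ≡ (m + 3 * t) + 2 * m
  distrib = solve-∀

module Matching {N : ℕ} (G : Graph N) (n : ℕ) (v : Fin N) where
  open Draft

  record Stage (m : ℕ) : Set where
    field
      pool       : List (Fin N)
      draft      : Draft G v m pool
      neighbours : All (Adj G v) pool
      large      : 3 * n ≤ length pool + 2 * m
  open Stage

  advance : ∀ {m a b I′} (s : Stage m) → pool s ↭ a ∷ b ∷ I′ → Draft G v (suc m) I′ → Stage (suc m)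
  advance {m} {I′ = I′} s pool↭ d = record
    { pool       = I′
    ; draft      = d
    ; neighbours = All.tail (All.tail (All-resp-↭ pool↭ (neighbours s)))
    ; large      = subst (3 * n ≤_) (two-matched (length I′) m)
                     (subst (λ l → 3 * n ≤ l + 2 * m) (↭-length pool↭) (large s))
    }
    where
    two-matched : ∀ l m → suc (suc l) + 2 * m ≡ l + 2 * suc m
    two-matched = solve-∀

  take-edge : ∀ {m} (s : Stage m) → HasEdge G (pool s) → Stage (suc m)
  take-edge s (a , b , a∈ , b∈ , a~b)
    with I′ , pool↭ ← ∈×∈⇒↭∷∷ a∈ b∈ (λ { refl → irrefl G a a~b })
    = advance s pool↭ (grow (reorder (draft s) pool↭) (v~ a∈ , v~ b∈ , a~b))
    where
    v~ : ∀ {w} → w ∈ pool s → Adj G v w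
    v~ = All.lookup (neighbours s)

  augment : ∀ {m} (s : Stage m) → Any (Augmenting G (pool s)) (triangles (draft s)) → Stage (suc m)
  augment s aug
    with (x , y) , xy∈ , (a , b , a∈ , b∈ , a≢b , x~a , y~b) ← find aug
    with I′ , pool↭ ← ∈×∈⇒↭∷∷ a∈ b∈ a≢b
    = let (v~x , v~y , _) = All.lookup (triangular (draft s)) xy∈
          v~ = All.lookup (neighbours s)
      in advance s pool↭
           (exchange (reorder (draft s) pool↭) xy∈ (v~ a∈ , v~x , sym G x~a) (v~y , v~ b∈ , y~b))

  search : ∀ {m} k → Stage m → m + k ≡ n → ContainsFan n G ⊎ ContainsFan n (complement G)
  search {m} zero s m+0≡n =
    inj₁ (subst (λ j → ContainsFan j G) (≡.trans (≡.sym (+-identityʳ m)) m+0≡n) (Draft⇒fan (draft s)))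
  search {m} (suc k) s m+k≡n with hasEdge? G (pool s)
  ... | yes e = search k (take-edge s e) (≡.trans (≡.sym (+-suc m k)) m+k≡n)
  ... | no ¬e with any? (augmenting? G (pool s)) (triangles (draft s))
  ... | yes aug = search k (augment s aug) (≡.trans (≡.sym (+-suc m k)) m+k≡n)
  ... | no ¬aug = inj₂ (subst (λ j → ContainsFan j (complement G)) |T|+k≡n
    (ComplementFan.stuck⇒complement-fan G I independent T k
      (AllPairs.tail (unique (draft s))) (¬Any⇒All¬ T ¬aug) room))
    where
    I : List (Fin N)
    I = pool s

    T : List (Fin N × Fin N)
    T = triangles (draft s)

    independent : ∀ {a b} → a ∈ I → b ∈ I → ¬ Adj G a b
    independent a∈ b∈ a~b = ¬e (_ , _ , a∈ , b∈ , a~b)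

    |T|+k≡n : length T + suc k ≡ n
    |T|+k≡n = ≡.trans (cong (_+ suc k) (count (draft s))) m+k≡n

    room : length T + 3 * suc k ≤ length I
    room = subst (λ j → j + 3 * suc k ≤ length I) (≡.sym (count (draft s)))
      (room-of-large m (suc k) (length I)
        (subst (λ j → 3 * j ≤ length I + 2 * m) (≡.sym m+k≡n) (large s)))

fan-at-high-degree-vertex : ∀ {N} (G : Graph N) n v → 3 * n ≤ degree G v →
                            ContainsFan n G ⊎ ContainsFan n (complement G)
fan-at-high-degree-vertex {N} G n v 3n≤deg = Matching.search G n v n initial refl
  where
  neighbourhood : List (Fin N)
  neighbourhood = filter (adj? G v) (allFin N)

  adjacent : All (Adj G v) neighbourhood
  adjacent = all-filter (adj? G v) (allFin N)

  v∉neighbourhood : All (v ≢_) neighbourhood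
  v∉neighbourhood = All.map (λ v~w v≡w → irrefl G v (subst (Adj G v) (≡.sym v≡w) v~w)) adjacent

  initial : Matching.Stage G n v 0
  initial = record
    { pool       = neighbourhood
    ; draft      = emptyDraft (v∉neighbourhood ∷ filter⁺ (adj? G v) (allFin⁺ N))
    ; neighbours = adjacent
    ; large      = subst (3 * n ≤_) (≡.sym (+-identityʳ _)) 3n≤deg
    }

corollary7 : (n : ℕ) → .{{_ : NonZero n}} → (N : ℕ) → (G : Graph N) →
    3 * n ≤ maxDegree G → ContainsFan n G ⊎ ContainsFan n (complement G)
corollary7 n N G 3n≤Δ =
  let (v , _ , 3n≤deg) = find (AnyP.map⁻ (≤-foldr-⊔⇒Any (map (degree G) (allFin N)) 0<3n 3n≤Δ))
  in fan-at-high-degree-vertex G n v 3n≤deg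
  where
  0<3n : 0 < 3 * n
  0<3n = ≤-trans (>-nonZero⁻¹ n) (m≤m+n n _)
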